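{- Let $X=(V,E)$ be a digraph. Then its Redei-Berge symmetric function has the expansion \[U_X=\sum_{\mathcal{F}}|\Sigma_V(\mathcal{F},X)|\,M_{\mathcal{F}},\] where the sum is over all compositions $\mathcal{F}$ of $V$.
   Context: A digraph is a pair $X=(V,E)$ with $V$ finite and $E\subset\{(u,v)\in V\times V\mid u\ne v\}$; $n=|V|$. $\mathbb{P}=\{1,2,\dots\}$. A $V$-listing is a bijection $\sigma:[n]\to V$; $\Sigma_V$ is the set of $V$-listings; $X\mathrm{Des}(\sigma)=\{1\le i\le n-1\mid(\sigma_i,\sigma_{i+1})\in E\}$. For $I\subset[n-1]$ the fundamental quasisymmetric function is $F_I=\sum x_{i_1}\cdots x_{i_n}$ over $1\le i_1\le\cdots\le i_n$ with $i_j<i_{j+1}$ for each $j\in I$. The Redei-Berge symmetric function is $U_X=\sum_{\sigma\in\Sigma_V}F_{X\mathrm{Des}(\sigma)}$. For a coloring $f:V\to\mathbb{P}$, $\mathbf{x}_f=\prod_{v\in V}x_{f(v)}$, and $\sigma$ is $(f,X)$-friendly if $f(\sigma_1)\le\cdots\le f(\sigma_n)$ and $f(\sigma_j)<f(\sigma_{j+1})$ whenever $(\sigma_j,\sigma_{j+1})\in E$. A composition of $V$ is an ordered tuple $\mathcal{F}=(V_1,\dots,V_k)$ of disjoint nonempty subsets with union $V$. An $\mathcal{F}$-coloring is a coloring constant on each block with strictly smaller values on earlier blocks; $M_{\mathcal{F}}=\sum_{f\ \mathcal{F}\text{ -coloring}}\mathbf{x}_f$ (this equals the monomial quasisymmetric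 function $M_{(|V_1|,\dots,|V_k|)}$, where $M_{(a_1,\dots,a_k)}=\sum_{i_1<\cdots<i_k}x_{i_1}^{a_1}\cdots x_{i_k}^{a_k}$). $\sigma$ is $(\mathcal{F},X)$-friendly if it is $(f,X)$-friendly for some $\mathcal{F}$-coloring $f$; $\Sigma_V(\mathcal{F},X)$ is the set of such listings. -}

module Defs where

open import Data.Bool using (Bool; true; false; _∧_; _∨_; not; if_then_else_)
open import Data.Nat using (ℕ; zero; suc; _+_; _*_; _≤_; _<_; _≡ᵇ_; _≤ᵇ_; _<ᵇ_)
open import Data.Fin using (Fin; toℕ) renaming (zero to fz; suc to fs)
open import Data.Fin.Properties using () renaming (_≟_ to _≟F_)
open import Data.List using (List; []; _∷_; map; concatMap; allFin; upTo; filterᵇ; length)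
open import Data.Nat.ListAction using (sum)
open import Data.Product using (Σ; _×_; _,_)
open import Relation.Nullary using (¬_)
open import Relation.Nullary.Decidable using (⌊_⌋)
open import Relation.Binary.PropositionalEquality using (_≡_)

allᵇ : ∀ {a} → (Fin a → Bool) → Bool
allᵇ {zero}  p = true
allᵇ {suc a} p = p fz ∧ allᵇ (λ i → p (fs i))

anyᵇ : ∀ {a} → (Fin a → Bool) → Bool
anyᵇ {zero}  p = false
anyᵇ {suc a} p = p fz ∨ anyᵇ (λ i → p (fs i))

_⇒ᵇ_ : Bool → Bool → Bool
x ⇒ᵇ y = not x ∨ y

_==F_ : ∀ {a} → Fin a → Fin a → Bool
i ==F j = ⌊ i ≟F j ⌋

nextᵇ : ∀ {a} → Fin a → Fin a → Bool
nextᵇ i j = toℕ j ≡ᵇ suc (toℕ i)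

-- Enumeration of all functions Fin a → Fin b (each exactly once)

cons : ∀ {a b} → Fin b → (Fin a → Fin b) → Fin (suc a) → Fin b
cons y f fz     = y
cons y f (fs i) = f i

funs : ∀ a b → List (Fin a → Fin b)
funs zero    b = (λ ()) ∷ []
funs (suc a) b = concatMap (λ f → map (λ y → cons y f) (allFin b)) (funs a b)

countFuns : ∀ a b → ((Fin a → Fin b) → Bool) → ℕ
countFuns a b p = length (filterᵇ p (funs a b))

-- Vertex set V = Fin n; a digraph is given by its (Boolean) edge relation
-- E u v = true  iff  (u , v) ∈ E.

Digraph : ℕ → Set
Digraph n = Fin n → Fin n → Bool

Loopless : ∀ {n} → Digraph n → Set
Loopless E = ∀ v → E v v ≡ false

-- V-listings: bijections σ : [n] → V  (position i ∈ Fin n is 1-based i+1)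
isListingᵇ : ∀ {n} → (Fin n → Fin n) → Bool
isListingᵇ σ = allᵇ λ i → allᵇ λ j → (σ i ==F σ j) ⇒ᵇ (i ==F j)

listings : (n : ℕ) → List (Fin n → Fin n)
listings n = filterᵇ isListingᵇ (funs n n)

-- XDes(σ) ⊆ [n-1], as a Boolean predicate on ℕ:
-- k ∈ XDes(σ) iff (σ_k , σ_{k+1}) ∈ E  (1-based positions)
XDes : ∀ {n} → Digraph n → (Fin n → Fin n) → ℕ → Bool
XDes E σ k = anyᵇ λ i → anyᵇ λ j →
  nextᵇ i j ∧ ((suc (toℕ i) ≡ᵇ k) ∧ E (σ i) (σ j))

-- Coefficients of quasisymmetric functions, restricted to the variables
-- x_1, …, x_m (variable x_{c+1} ↔ c : Fin m).  A monomial in these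
-- variables is an exponent vector α : Fin m → ℕ.

mult : ∀ {a m} → (Fin a → Fin m) → Fin m → ℕ
mult {a} s c = length (filterᵇ (λ i → s i ==F c) (allFin a))

hasContentᵇ : ∀ {a m} → (Fin a → Fin m) → (Fin m → ℕ) → Bool
hasContentᵇ s α = allᵇ λ c → mult s c ≡ᵇ α c

-- coefficient of x^α in F_I(x_1,…,x_m) (I ⊆ [n-1] given by I : ℕ → Bool):
-- number of sequences i_1 ≤ ⋯ ≤ i_n in [m] with i_j < i_{j+1} for j ∈ I
-- and x_{i_1}⋯x_{i_n} = x^α
Fcoeff : (n m : ℕ) → (ℕ → Bool) → (Fin m → ℕ) → ℕ
Fcoeff n m I α = countFuns n m λ s →
  (allᵇ λ i → allᵇ λ j → nextᵇ i j ⇒ᵇ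
     ((toℕ (s i) ≤ᵇ toℕ (s j)) ∧ (I (suc (toℕ i)) ⇒ᵇ (toℕ (s i) <ᵇ toℕ (s j)))))
  ∧ hasContentᵇ s α

-- coefficient of x^α in U_X(x_1,…,x_m) = Σ_σ F_{XDes(σ)}
Ucoeff : ∀ {n} → Digraph n → (m : ℕ) → (Fin m → ℕ) → ℕ
Ucoeff {n} E m α = sum (map (λ σ → Fcoeff n m (XDes E σ) α) (listings n))

-- Compositions of V = Fin n with k blocks are encoded as surjections
-- g : Fin n → Fin k  (block V_{b+1} = g⁻¹(b)).

isSurjᵇ : ∀ {n k} → (Fin n → Fin k) → Bool
isSurjᵇ g = allᵇ λ b → anyᵇ λ v → g v ==F b

-- coefficient of x^α in M_𝓕(x_1,…,x_m) = Σ_{𝓕-colorings f} x_f :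
-- an 𝓕-coloring with values in [m] is f = h ∘ g with h : Fin k → Fin m
-- strictly increasing
Mcoeff : ∀ {n k} → (Fin n → Fin k) → (m : ℕ) → (Fin m → ℕ) → ℕ
Mcoeff {n} {k} g m α = countFuns k m λ h →
  (allᵇ λ a → allᵇ λ b → (toℕ a <ᵇ toℕ b) ⇒ᵇ (toℕ (h a) <ᵇ toℕ (h b)))
  ∧ hasContentᵇ (λ v → h (g v)) α

-- Colorings f : V → ℙ (represented as ℕ-valued with 0 < f v)

IsFColoring : ∀ {n k} → (Fin n → Fin k) → (Fin n → ℕ) → Set
IsFColoring g f =
  (∀ v → 0 < f v) ×
  (∀ u v → g u ≡ g v → f u ≡ f v) ×
  (∀ u v → toℕ (g u) < toℕ (g v) → f u < f v)

IsFriendly : ∀ {n} → Digraph n → (Fin n → ℕ) → (Fin n → Fin n) → Set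
IsFriendly E f σ = ∀ i j → toℕ j ≡ suc (toℕ i) →
  (f (σ i) ≤ f (σ j)) × (E (σ i) (σ j) ≡ true → f (σ i) < f (σ j))

IsFXFriendly : ∀ {n k} → Digraph n → (Fin n → Fin k) → (Fin n → Fin n) → Set
IsFXFriendly {n} E g σ = Σ (Fin n → ℕ) λ f → IsFColoring g f × IsFriendly E f σ

-- HasCount P xs c : exactly c entries of the list xs satisfy P.
-- (Applied to the duplicate-free list of all V-listings this says
--  |{σ ∈ Σ_V ∣ P σ}| = c.)

data HasCount {A : Set} (P : A → Set) : List A → ℕ → Set where
  hc-[]  : HasCount P [] 0
  hc-yes : ∀ {x xs c} → P x → HasCount P xs c → HasCount P (x ∷ xs) (suc c)
  hc-no  : ∀ {x xs c} → ¬ P x → HasCount P xs c → HasCount P (x ∷ xs) c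

sumCompositions : (n : ℕ) → ((k : ℕ) → (Fin n → Fin k) → ℕ) → ℕ
sumCompositions n t =
  sum (map (λ k → sum (map (t k) (filterᵇ isSurjᵇ (funs n k)))) (upTo (suc n)))

{-# OPTIONS --safe #-}
module Submission where

-- Fix a listing σ.  A sequence counted by F_{XDes σ} has the form s = f ∘ σ for a colouring
-- f of the vertices, and f factors uniquely as h ∘ g with g : V ↠ Fin k a composition of V
-- and h : Fin k → ℙ strictly increasing.  Since h is increasing, s rises weakly, and strictly
-- at the X-descents of σ, exactly when g ∘ σ does, i.e. exactly when σ is (g, X)-friendly;
-- the remaining choice of h is what M_g counts.  Summing over σ and exchanging the sums
-- gives U_X = Σ_g |Σ_V(g, X)| M_g.

open import Defs
open import Algebra.Properties.CommutativeSemigroup using (interchange)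
open import Data.Bool using (Bool; true; false; _∧_; T)
open import Data.Bool.Properties using (T-∧; T-∨; T-≡)
open import Data.Empty using (⊥-elim)
open import Data.Fin as Fin using (Fin; toℕ; punchIn; punchOut) renaming (zero to fz; suc to fs)
open import Data.Fin.Properties
  using (any?; _≟_; toℕ-injective; punchOut-injective; punchIn-punchOut; injective⇒≤;
         <⇒notInjective; cantor-schröder-bernstein)
  renaming (suc-injective to fs-injective)
open import Data.List using (List; []; _∷_; map; concatMap; allFin; upTo; applyUpTo; filterᵇ; length; _++_)
open import Data.List.Properties using (map-tabulate)
open import Data.Nat using (ℕ; zero; suc; _+_; _*_; _≤_; _<_; _<?_; _≡ᵇ_; _≤ᵇ_; _<ᵇ_; z≤n; s≤s; z<s)
open import Data.Nat.ListAction using (sum)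
open import Data.Nat.Properties
  using (+-identityʳ; +-assoc; +-suc; *-zeroʳ; *-comm; *-assoc; *-distribˡ-+;
         +-commutativeSemigroup; suc-injective; ≤-reflexive; ≤-trans; ≤-antisym; ≤-<-trans;
         <-≤-trans; <⇒≤; <⇒≱; ≮⇒≥; ≰⇒>; ≤∧≢⇒<; <-irrefl; m≤n⇒m<n∨m≡n; n<1+n;
         ≡ᵇ⇒≡; ≡⇒≡ᵇ; <ᵇ⇒<; <⇒<ᵇ; ≤ᵇ⇒≤; ≤⇒≤ᵇ)
open import Data.Product using (_×_; _,_; proj₁; proj₂; ∃) renaming (map to map-×)
open import Data.Sum using (_⊎_; inj₁; inj₂)
open import Function using (id; _∘_; _⇔_; mk⇔; Equivalence)
open import Function.Construct.Composition using (_⇔-∘_)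
open import Function.Construct.Symmetry using (⇔-sym)
open import Function.Definitions using (Injective; StrictlySurjective)
open import Relation.Binary.Core using (_Preserves_⟶_)
open import Relation.Binary.PropositionalEquality
open import Relation.Nullary using (¬_; yes; no; contradiction)
open import Relation.Nullary.Decidable using (toWitness; fromWitness)

open Equivalence using (to; from)

variable
  A B : Set
  a b k m n : ℕ

∑ : List A → (A → ℕ) → ℕ
∑ []       f = 0
∑ (x ∷ xs) f = f x + ∑ xs f

syntax ∑ xs (λ x → e) = ∑[ x ∈ xs ] e

sum-map : (xs : List A) (f : A → ℕ) → sum (map f xs) ≡ ∑ xs f
sum-map []       f = refl
sum-map (x ∷ xs) f = cong (f x +_) (sum-map xs f)

∑-cong : (xs : List A) {f g : A → ℕ} → f ≗ g → ∑ xs f ≡ ∑ xs g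
∑-cong []       f≗g = refl
∑-cong (x ∷ xs) f≗g = cong₂ _+_ (f≗g x) (∑-cong xs f≗g)

∑-zero : (xs : List A) → ∑[ x ∈ xs ] 0 ≡ 0
∑-zero []       = refl
∑-zero (x ∷ xs) = ∑-zero xs

∑-+ : (xs : List A) (f g : A → ℕ) → ∑[ x ∈ xs ] (f x + g x) ≡ ∑ xs f + ∑ xs g
∑-+ []       f g = refl
∑-+ (x ∷ xs) f g = trans (cong (f x + g x +_) (∑-+ xs f g))
                         (interchange +-commutativeSemigroup (f x) (g x) (∑ xs f) (∑ xs g))

*-distribˡ-∑ : (c : ℕ) (xs : List A) (f : A → ℕ) → c * ∑ xs f ≡ ∑[ x ∈ xs ] (c * f x)
*-distribˡ-∑ c []       f = *-zeroʳ c
*-distribˡ-∑ c (x ∷ xs) f =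
  trans (*-distribˡ-+ c (f x) (∑ xs f)) (cong (c * f x +_) (*-distribˡ-∑ c xs f))

*-distribʳ-∑ : (c : ℕ) (xs : List A) (f : A → ℕ) → ∑ xs f * c ≡ ∑[ x ∈ xs ] (f x * c)
*-distribʳ-∑ c xs f =
  trans (*-comm (∑ xs f) c) (trans (*-distribˡ-∑ c xs f) (∑-cong xs (λ x → *-comm c (f x))))

∑-*-∑ : (xs : List A) (ys : List B) (f : A → ℕ) (g : B → ℕ) →
        ∑[ x ∈ xs ] ∑[ y ∈ ys ] (f x * g y) ≡ ∑ xs f * ∑ ys g
∑-*-∑ xs ys f g = begin
  ∑[ x ∈ xs ] ∑[ y ∈ ys ] (f x * g y) ≡⟨ ∑-cong xs (λ x → *-distribˡ-∑ (f x) ys g) ⟨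
  ∑[ x ∈ xs ] (f x * ∑ ys g)          ≡⟨ *-distribʳ-∑ (∑ ys g) xs f ⟨
  ∑ xs f * ∑ ys g                     ∎
  where open ≡-Reasoning

∑-swap : (xs : List A) (ys : List B) (f : A → B → ℕ) →
         ∑[ x ∈ xs ] ∑[ y ∈ ys ] f x y ≡ ∑[ y ∈ ys ] ∑[ x ∈ xs ] f x y
∑-swap []       ys f = sym (∑-zero ys)
∑-swap (x ∷ xs) ys f =
  trans (cong (∑ ys (f x) +_) (∑-swap xs ys f)) (sym (∑-+ ys (f x) (λ y → ∑[ x ∈ xs ] f x y)))

∑-++ : (xs ys : List A) (f : A → ℕ) → ∑ (xs ++ ys) f ≡ ∑ xs f + ∑ ys f
∑-++ []       ys f = refl
∑-++ (x ∷ xs) ys f = trans (cong (f x +_) (∑-++ xs ys f)) (sym (+-assoc (f x) _ _))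

∑-map : (g : A → B) (xs : List A) (f : B → ℕ) → ∑ (map g xs) f ≡ ∑[ x ∈ xs ] f (g x)
∑-map g []       f = refl
∑-map g (x ∷ xs) f = cong (f (g x) +_) (∑-map g xs f)

∑-concatMap : (g : A → List B) (xs : List A) (f : B → ℕ) →
              ∑ (concatMap g xs) f ≡ ∑[ x ∈ xs ] ∑ (g x) f
∑-concatMap g []       f = refl
∑-concatMap g (x ∷ xs) f =
  trans (∑-++ (g x) (concatMap g xs) f) (cong (∑ (g x) f +_) (∑-concatMap g xs f))

∑-allFin-suc : (f : Fin (suc n) → ℕ) → ∑ (allFin (suc n)) f ≡ f fz + ∑[ i ∈ allFin n ] f (fs i)
∑-allFin-suc {n} f = cong (f fz +_)
  (trans (cong (λ is → ∑ is f) (sym (map-tabulate id fs))) (∑-map fs (allFin n) f))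

∑-applyUpTo-zero : (g : ℕ → A) (f : A → ℕ) → (∀ i → f (g i) ≡ 0) → ∑ (applyUpTo g n) f ≡ 0
∑-applyUpTo-zero {n = zero}  g f f∘g≡0 = refl
∑-applyUpTo-zero {n = suc n} g f f∘g≡0 =
  cong₂ _+_ (f∘g≡0 0) (∑-applyUpTo-zero {n = n} (g ∘ suc) f (f∘g≡0 ∘ suc))

∑-applyUpTo-single : (g : ℕ → A) (f : A → ℕ) {j : ℕ} → j < n →
                     (∀ i → i ≢ j → f (g i) ≡ 0) → ∑ (applyUpTo g n) f ≡ f (g j)
∑-applyUpTo-single {n = suc n} g f {zero} _ vanish =
  trans (cong (f (g 0) +_) (∑-applyUpTo-zero {n = n} (g ∘ suc) f (λ i → vanish (suc i) λ ())))
        (+-identityʳ (f (g 0)))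
∑-applyUpTo-single g f {suc j} (s≤s j<n) vanish =
  cong₂ _+_ (vanish 0 λ ())
            (∑-applyUpTo-single (g ∘ suc) f j<n (λ i i≢j → vanish (suc i) (i≢j ∘ suc-injective)))

𝟙 : Bool → ℕ
𝟙 true  = 1
𝟙 false = 0

𝟙-true : ∀ {x} → T x → 𝟙 x ≡ 1
𝟙-true {true} _ = refl

𝟙-false : ∀ {x} → ¬ T x → 𝟙 x ≡ 0
𝟙-false {true}  ¬x = contradiction _ ¬x
𝟙-false {false} ¬x = refl

𝟙-∧ : ∀ x y → 𝟙 (x ∧ y) ≡ 𝟙 x * 𝟙 y
𝟙-∧ true  y = sym (+-identityʳ (𝟙 y))
𝟙-∧ false y = refl

𝟙-∧-* : ∀ x y z → 𝟙 (x ∧ y) * z ≡ 𝟙 x * (𝟙 y * z)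
𝟙-∧-* x y z = trans (cong (_* z) (𝟙-∧ x y)) (*-assoc (𝟙 x) (𝟙 y) z)

T-injective : ∀ {x y} → T x ⇔ T y → x ≡ y
T-injective {true}  {true}  _   = refl
T-injective {true}  {false} x⇔y = ⊥-elim (to x⇔y _)
T-injective {false} {true}  x⇔y = ⊥-elim (from x⇔y _)
T-injective {false} {false} _   = refl

⇔⇒≡ : ∀ {x y} {P Q : Set} → T x ⇔ P → T y ⇔ Q → P ⇔ Q → x ≡ y
⇔⇒≡ x⇔P y⇔Q P⇔Q = T-injective (⇔-sym y⇔Q ⇔-∘ (P⇔Q ⇔-∘ x⇔P))

T-⇒ᵇ : ∀ {x y} → T (x ⇒ᵇ y) ⇔ (T x → T y)
T-⇒ᵇ {true}  = mk⇔ (λ y _ → y) (λ x⇒y → x⇒y _)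
T-⇒ᵇ {false} = mk⇔ (λ _ ()) _

T-<ᵇ : ∀ {x y} → T (x <ᵇ y) ⇔ x < y
T-<ᵇ {x} {y} = mk⇔ (<ᵇ⇒< x y) <⇒<ᵇ

T-≤ᵇ : ∀ {x y} → T (x ≤ᵇ y) ⇔ x ≤ y
T-≤ᵇ {x} {y} = mk⇔ (≤ᵇ⇒≤ x y) ≤⇒≤ᵇ

T-allᵇ : {p : Fin a → Bool} → T (allᵇ p) ⇔ (∀ i → T (p i))
T-allᵇ {zero}      = mk⇔ (λ _ ()) _
T-allᵇ {suc a} {p} = mk⇔ to′ from′
  where
  to′ : T (allᵇ p) → ∀ i → T (p i)
  to′ all-p fz     = proj₁ (to T-∧ all-p)
  to′ all-p (fs i) = to T-allᵇ (proj₂ (to T-∧ all-p)) i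
  from′ : (∀ i → T (p i)) → T (allᵇ p)
  from′ p-all = from T-∧ (p-all fz , from T-allᵇ (p-all ∘ fs))

T-anyᵇ : {p : Fin a → Bool} → T (anyᵇ p) ⇔ ∃ (T ∘ p)
T-anyᵇ {zero}      = mk⇔ (λ ()) (λ ())
T-anyᵇ {suc a} {p} = mk⇔ to′ from′
  where
  to′ : T (anyᵇ p) → ∃ (T ∘ p)
  to′ any-p with to T-∨ any-p
  ... | inj₁ p₀ = fz , p₀
  ... | inj₂ ps with to T-anyᵇ ps
  ...   | i , pᵢ = fs i , pᵢ
  from′ : ∃ (T ∘ p) → T (anyᵇ p)
  from′ (fz   , p₀) = from T-∨ (inj₁ p₀)
  from′ (fs i , pᵢ) = from T-∨ (inj₂ (from T-anyᵇ (i , pᵢ)))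

allᵇ-cong : {p q : Fin a → Bool} → p ≗ q → allᵇ p ≡ allᵇ q
allᵇ-cong {zero}  p≗q = refl
allᵇ-cong {suc a} p≗q = cong₂ _∧_ (p≗q fz) (allᵇ-cong (p≗q ∘ fs))

T-==F : {i j : Fin a} → T (i ==F j) ⇔ i ≡ j
T-==F = mk⇔ toWitness fromWitness

==F-⇔ : {i j : Fin a} {i′ j′ : Fin b} → i ≡ j ⇔ i′ ≡ j′ → (i ==F j) ≡ (i′ ==F j′)
==F-⇔ = ⇔⇒≡ T-==F T-==F

T-nextᵇ : {i j : Fin a} → T (nextᵇ i j) ⇔ toℕ j ≡ suc (toℕ i)
T-nextᵇ {i = i} {j} = mk⇔ (≡ᵇ⇒≡ (toℕ j) (suc (toℕ i))) (≡⇒≡ᵇ (toℕ j) (suc (toℕ i)))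

infix 4 _≗ᵇ_

_≗ᵇ_ : (f g : Fin a → Fin b) → Bool
f ≗ᵇ g = allᵇ λ i → f i ==F g i

T-≗ᵇ : {f g : Fin a → Fin b} → T (f ≗ᵇ g) ⇔ f ≗ g
T-≗ᵇ = mk⇔ (λ f≗ᵇg i → to T-==F (to T-allᵇ f≗ᵇg i))
           (λ f≗g → from T-allᵇ (from T-==F ∘ f≗g))

≗ᵇ-⇔ : {f g : Fin a → Fin b} {f′ g′ : Fin k → Fin m} →
       f ≗ g ⇔ f′ ≗ g′ → (f ≗ᵇ g) ≡ (f′ ≗ᵇ g′)
≗ᵇ-⇔ = ⇔⇒≡ T-≗ᵇ T-≗ᵇ

∑-filterᵇ : (p : A → Bool) (xs : List A) (f : A → ℕ) →
            ∑ (filterᵇ p xs) f ≡ ∑[ x ∈ xs ] (𝟙 (p x) * f x)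
∑-filterᵇ p []       f = refl
∑-filterᵇ p (x ∷ xs) f with p x
... | true  = cong₂ _+_ (sym (+-identityʳ (f x))) (∑-filterᵇ p xs f)
... | false = ∑-filterᵇ p xs f

length-filterᵇ : (p : A → Bool) (xs : List A) → length (filterᵇ p xs) ≡ ∑[ x ∈ xs ] 𝟙 (p x)
length-filterᵇ p []       = refl
length-filterᵇ p (x ∷ xs) with p x
... | true  = cong suc (length-filterᵇ p xs)
... | false = length-filterᵇ p xs

∑-filterᵇ-cong : (p : A → Bool) (xs : List A) {f g : A → ℕ} → (∀ x → T (p x) → f x ≡ g x) →
                 ∑ (filterᵇ p xs) f ≡ ∑ (filterᵇ p xs) g
∑-filterᵇ-cong p []       f≡g = refl
∑-filterᵇ-cong p (x ∷ xs) f≡g with p x in px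
... | true  = cong₂ _+_ (f≡g x (from T-≡ px)) (∑-filterᵇ-cong p xs f≡g)
... | false = ∑-filterᵇ-cong p xs f≡g

∑-filterᵇ² : (p : A → Bool) (q : B → Bool) (xs : List A) (ys : List B) (f : A → B → ℕ) →
             ∑[ x ∈ filterᵇ p xs ] ∑[ y ∈ filterᵇ q ys ] f x y
               ≡ ∑[ x ∈ xs ] ∑[ y ∈ ys ] (𝟙 (p x ∧ q y) * f x y)
∑-filterᵇ² p q xs ys f = begin
  ∑[ x ∈ filterᵇ p xs ] ∑[ y ∈ filterᵇ q ys ] f x y
    ≡⟨ ∑-filterᵇ p xs _ ⟩
  ∑[ x ∈ xs ] (𝟙 (p x) * ∑[ y ∈ filterᵇ q ys ] f x y)
    ≡⟨ ∑-cong xs (λ x → cong (𝟙 (p x) *_) (∑-filterᵇ q ys (f x))) ⟩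
  ∑[ x ∈ xs ] (𝟙 (p x) * ∑[ y ∈ ys ] (𝟙 (q y) * f x y))
    ≡⟨ ∑-cong xs (λ x → *-distribˡ-∑ (𝟙 (p x)) ys _) ⟩
  ∑[ x ∈ xs ] ∑[ y ∈ ys ] (𝟙 (p x) * (𝟙 (q y) * f x y))
    ≡⟨ ∑-cong xs (λ x → ∑-cong ys (λ y → 𝟙-∧-* (p x) (q y) (f x y))) ⟨
  ∑[ x ∈ xs ] ∑[ y ∈ ys ] (𝟙 (p x ∧ q y) * f x y) ∎
  where open ≡-Reasoning

∑-allFin-δ : (j : Fin b) (w : Fin b → ℕ) → ∑[ i ∈ allFin b ] (𝟙 (i ==F j) * w i) ≡ w j
∑-allFin-δ {suc b} fz w = begin
  ∑[ i ∈ allFin (suc b) ] (𝟙 (i ==F fz) * w i)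
    ≡⟨ ∑-allFin-suc (λ i → 𝟙 (i ==F fz) * w i) ⟩
  w fz + 0 + ∑[ i ∈ allFin b ] 0
    ≡⟨ cong₂ _+_ (+-identityʳ (w fz)) (∑-zero (allFin b)) ⟩
  w fz + 0
    ≡⟨ +-identityʳ (w fz) ⟩
  w fz ∎
  where open ≡-Reasoning
∑-allFin-δ {suc b} (fs j) w = begin
  ∑[ i ∈ allFin (suc b) ] (𝟙 (i ==F fs j) * w i)
    ≡⟨ ∑-allFin-suc (λ i → 𝟙 (i ==F fs j) * w i) ⟩
  ∑[ i ∈ allFin b ] (𝟙 (fs i ==F fs j) * w (fs i))
    ≡⟨ ∑-cong (allFin b) (λ i → cong (λ x → 𝟙 x * w (fs i)) (fs==Ffs i)) ⟩
  ∑[ i ∈ allFin b ] (𝟙 (i ==F j) * w (fs i))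
    ≡⟨ ∑-allFin-δ j (w ∘ fs) ⟩
  w (fs j) ∎
  where
  open ≡-Reasoning
  fs==Ffs : ∀ i → (fs i ==F fs j) ≡ (i ==F j)
  fs==Ffs i = ==F-⇔ (mk⇔ fs-injective (cong fs))

cons-η : (f : Fin (suc a) → Fin b) → cons (f fz) (f ∘ fs) ≗ f
cons-η f fz     = refl
cons-η f (fs i) = refl

∑-funs-δ : (f₀ : Fin a → Fin b) (w : (Fin a → Fin b) → ℕ) → w Preserves _≗_ ⟶ _≡_ →
           ∑[ f ∈ funs a b ] (𝟙 (f ≗ᵇ f₀) * w f) ≡ w f₀
∑-funs-δ {zero}      f₀ w w-resp = trans (+-identityʳ _) (trans (+-identityʳ _) (w-resp λ ()))
∑-funs-δ {suc a} {b} f₀ w w-resp = begin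
  ∑[ f ∈ funs (suc a) b ] (𝟙 (f ≗ᵇ f₀) * w f)
    ≡⟨ ∑-concatMap (λ f → map (λ y → cons y f) (allFin b)) (funs a b) _ ⟩
  ∑[ f ∈ funs a b ] ∑ (map (λ y → cons y f) (allFin b)) (λ f → 𝟙 (f ≗ᵇ f₀) * w f)
    ≡⟨ ∑-cong (funs a b) (λ f → ∑-map (λ y → cons y f) (allFin b) _) ⟩
  ∑[ f ∈ funs a b ] ∑[ y ∈ allFin b ] (𝟙 ((y ==F f₀ fz) ∧ (f ≗ᵇ f₀ ∘ fs)) * w (cons y f))
    ≡⟨ ∑-cong (funs a b) (λ f → ∑-cong (allFin b) (λ y → 𝟙-∧-* (y ==F f₀ fz) _ _)) ⟩
  ∑[ f ∈ funs a b ] ∑[ y ∈ allFin b ] (𝟙 (y ==F f₀ fz) * (𝟙 (f ≗ᵇ f₀ ∘ fs) * w (cons y f)))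
    ≡⟨ ∑-cong (funs a b) (λ f →
         ∑-allFin-δ (f₀ fz) (λ y → 𝟙 (f ≗ᵇ f₀ ∘ fs) * w (cons y f))) ⟩
  ∑[ f ∈ funs a b ] (𝟙 (f ≗ᵇ f₀ ∘ fs) * w (cons (f₀ fz) f))
    ≡⟨ ∑-funs-δ (f₀ ∘ fs) (w ∘ cons (f₀ fz)) (w-resp ∘ cons-resp) ⟩
  w (cons (f₀ fz) (f₀ ∘ fs))
    ≡⟨ w-resp (cons-η f₀) ⟩
  w f₀ ∎
  where
  open ≡-Reasoning
  cons-resp : ∀ {f g : Fin a → Fin b} → f ≗ g → cons (f₀ fz) f ≗ cons (f₀ fz) g
  cons-resp f≗g fz     = refl
  cons-resp f≗g (fs i) = f≗g i

-- If j were missed, punching it out of σ would inject Fin (suc n) into Fin n.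
injective⇒surjective : {σ : Fin n → Fin n} → Injective _≡_ _≡_ σ → StrictlySurjective _≡_ σ
injective⇒surjective {zero}      σ-injective ()
injective⇒surjective {suc n} {σ} σ-injective j with any? (λ i → σ i ≟ j)
... | yes hit  = hit
... | no  miss = ⊥-elim (<⇒notInjective (n<1+n n) σ′-injective)
  where
  missed : ∀ i → j ≢ σ i
  missed i j≡σi = miss (i , sym j≡σi)
  σ′ : Fin (suc n) → Fin n
  σ′ i = punchOut (missed i)
  σ′-injective : Injective _≡_ _≡_ σ′
  σ′-injective {i} {i′} = σ-injective ∘ punchOut-injective (missed i) (missed i′)

module _ {σ : Fin n → Fin n} (σ-injective : Injective _≡_ _≡_ σ) where
  private
    σ⁻¹ : Fin n → Fin n
    σ⁻¹ j = proj₁ (injective⇒surjective σ-injective j)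

    σ∘σ⁻¹ : ∀ j → σ (σ⁻¹ j) ≡ j
    σ∘σ⁻¹ j = proj₂ (injective⇒surjective σ-injective j)

    σ⁻¹∘σ : ∀ i → σ⁻¹ (σ i) ≡ i
    σ⁻¹∘σ i = σ-injective (σ∘σ⁻¹ (σ i))

  ∑-allFin-∘-injective : (w : Fin n → ℕ) → ∑[ i ∈ allFin n ] w (σ i) ≡ ∑ (allFin n) w
  ∑-allFin-∘-injective w = begin
    ∑[ i ∈ allFin n ] w (σ i)
      ≡⟨ ∑-cong (allFin n) (λ i → ∑-allFin-δ (σ i) w) ⟨
    ∑[ i ∈ allFin n ] ∑[ j ∈ allFin n ] (𝟙 (j ==F σ i) * w j)
      ≡⟨ ∑-swap (allFin n) (allFin n) _ ⟩
    ∑[ j ∈ allFin n ] ∑[ i ∈ allFin n ] (𝟙 (j ==F σ i) * w j)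
      ≡⟨ ∑-cong (allFin n) (λ j → ∑-cong (allFin n) (λ i →
           cong (λ x → 𝟙 x * w j) (==F-⇔ (inverse i j)))) ⟩
    ∑[ j ∈ allFin n ] ∑[ i ∈ allFin n ] (𝟙 (i ==F σ⁻¹ j) * w j)
      ≡⟨ ∑-cong (allFin n) (λ j → ∑-allFin-δ (σ⁻¹ j) (λ _ → w j)) ⟩
    ∑[ j ∈ allFin n ] w j ∎
    where
    open ≡-Reasoning
    inverse : ∀ i j → j ≡ σ i ⇔ i ≡ σ⁻¹ j
    inverse i j = mk⇔ (λ { refl → sym (σ⁻¹∘σ i) }) (λ { refl → sym (σ∘σ⁻¹ j) })

  ∑-funs-∘-injective : (w : (Fin n → Fin b) → ℕ) → w Preserves _≗_ ⟶ _≡_ →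
                       ∑[ t ∈ funs n b ] w (t ∘ σ) ≡ ∑ (funs n b) w
  ∑-funs-∘-injective {b} w w-resp = begin
    ∑[ t ∈ funs n b ] w (t ∘ σ)
      ≡⟨ ∑-cong (funs n b) (λ t → ∑-funs-δ (t ∘ σ) w w-resp) ⟨
    ∑[ t ∈ funs n b ] ∑[ u ∈ funs n b ] (𝟙 (u ≗ᵇ t ∘ σ) * w u)
      ≡⟨ ∑-swap (funs n b) (funs n b) _ ⟩
    ∑[ u ∈ funs n b ] ∑[ t ∈ funs n b ] (𝟙 (u ≗ᵇ t ∘ σ) * w u)
      ≡⟨ ∑-cong (funs n b) (λ u → ∑-cong (funs n b) (λ t →
           cong (λ x → 𝟙 x * w u) (≗ᵇ-⇔ (inverse t u)))) ⟩
    ∑[ u ∈ funs n b ] ∑[ t ∈ funs n b ] (𝟙 (t ≗ᵇ u ∘ σ⁻¹) * w u)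
      ≡⟨ ∑-cong (funs n b) (λ u → ∑-funs-δ (u ∘ σ⁻¹) (λ _ → w u) (λ _ → refl)) ⟩
    ∑[ u ∈ funs n b ] w u ∎
    where
    open ≡-Reasoning
    inverse : ∀ t u → u ≗ t ∘ σ ⇔ t ≗ u ∘ σ⁻¹
    inverse t u = mk⇔ (λ u≗tσ j → trans (cong t (sym (σ∘σ⁻¹ j))) (sym (u≗tσ (σ⁻¹ j))))
                      (λ t≗uσ⁻¹ i → trans (cong u (sym (σ⁻¹∘σ i))) (sym (t≗uσ⁻¹ (σ i))))

Increasing : (Fin k → Fin m) → Set
Increasing h = h Preserves Fin._<_ ⟶ Fin._<_

module _ {h : Fin k → Fin m} (h-increasing : Increasing h) where

  increasing-mono-≤ : h Preserves Fin._≤_ ⟶ Fin._≤_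
  increasing-mono-≤ a≤b with m≤n⇒m<n∨m≡n a≤b
  ... | inj₁ a<b = <⇒≤ (h-increasing a<b)
  ... | inj₂ a≡b = ≤-reflexive (cong (toℕ ∘ h) (toℕ-injective a≡b))

  increasing-cancel-≤ : ∀ {a b} → h a Fin.≤ h b → a Fin.≤ b
  increasing-cancel-≤ ha≤hb = ≮⇒≥ (λ b<a → <⇒≱ (h-increasing b<a) ha≤hb)

  increasing-cancel-< : ∀ {a b} → h a Fin.< h b → a Fin.< b
  increasing-cancel-< ha<hb = ≰⇒> (λ b≤a → <⇒≱ ha<hb (increasing-mono-≤ b≤a))

  increasing⇒injective : Injective _≡_ _≡_ h
  increasing⇒injective ha≡hb = toℕ-injective (≤-antisym
    (increasing-cancel-≤ (≤-reflexive (cong toℕ ha≡hb)))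
    (increasing-cancel-≤ (≤-reflexive (cong toℕ (sym ha≡hb)))))

increasing-lower-bound : {h : Fin k → Fin m} → Increasing h → ∀ {d} → (∀ a → d ≤ toℕ (h a)) →
                         ∀ a → d + toℕ a ≤ toℕ (h a)
increasing-lower-bound {suc k} h-increasing {d} d≤h fz     =
  ≤-trans (≤-reflexive (+-identityʳ d)) (d≤h fz)
increasing-lower-bound {suc k} h-increasing {d} d≤h (fs a) =
  ≤-trans (≤-reflexive (+-suc d (toℕ a)))
          (increasing-lower-bound (h-increasing ∘ s≤s)
                                  (λ b → ≤-<-trans (d≤h fz) (h-increasing {fz} {fs b} z<s)) a)

increasing⇒inflationary : {h : Fin k → Fin m} → Increasing h → ∀ a → toℕ a ≤ toℕ (h a)
increasing⇒inflationary h-increasing = increasing-lower-bound h-increasing (λ _ → z≤n)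

cons-increasing : ∀ {x} {h : Fin k → Fin m} → (∀ a → x Fin.< h a) → Increasing h →
                  Increasing (cons x h)
cons-increasing x<h h-increasing {fz}   {fs b} _         = x<h b
cons-increasing x<h h-increasing {fs a} {fs b} (s≤s a<b) = h-increasing a<b

increasingᵇ : (Fin k → Fin m) → Bool
increasingᵇ h = allᵇ λ a → allᵇ λ b → (toℕ a <ᵇ toℕ b) ⇒ᵇ (toℕ (h a) <ᵇ toℕ (h b))

T-increasingᵇ : {h : Fin k → Fin m} → T (increasingᵇ h) ⇔ Increasing h
T-increasingᵇ {h = h} = mk⇔ to′ from′
  where
  to′ : T (increasingᵇ h) → Increasing h
  to′ h-inc {a} {b} a<b =
    to T-<ᵇ (to (T-⇒ᵇ {toℕ a <ᵇ toℕ b}) (to T-allᵇ (to T-allᵇ h-inc a) b) (from T-<ᵇ a<b))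
  from′ : Increasing h → T (increasingᵇ h)
  from′ h-inc = from T-allᵇ λ a → from T-allᵇ λ b →
    from (T-⇒ᵇ {toℕ a <ᵇ toℕ b}) λ a<b → from T-<ᵇ (h-inc {a} {b} (to T-<ᵇ a<b))

-- Image factorisation of a map Fin n → Fin m

punchIn-or-pivot : ∀ (p b : Fin (suc k)) → b ≡ p ⊎ ∃ λ a → punchIn p a ≡ b
punchIn-or-pivot p b with b ≟ p
... | yes b≡p = inj₁ b≡p
... | no  b≢p = inj₂ (punchOut (b≢p ∘ sym) , punchIn-punchOut (b≢p ∘ sym))

record Insertion (h : Fin k → Fin m) (c : Fin m) : Set where
  field
    pivot      : Fin (suc k)
    extension  : Fin (suc k) → Fin m
    increasing : Increasing extension
    at-pivot   : extension pivot ≡ c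
    elsewhere  : extension ∘ punchIn pivot ≗ h

insert : {h : Fin k → Fin m} → Increasing h → (c : Fin m) → (∀ a → h a ≢ c) → Insertion h c
insert {zero} h-increasing c c∉h = record
  { pivot = fz ; extension = λ _ → c ; increasing = λ { {fz} {fz} () }
  ; at-pivot = refl ; elsewhere = λ () }
insert {suc k} {h = h} h-increasing c c∉h with toℕ c <? toℕ (h fz)
... | yes c<h₀ = record
  { pivot = fz ; extension = cons c h
  ; increasing = cons-increasing (λ a → <-≤-trans c<h₀ (increasing-mono-≤ h-increasing z≤n)) h-increasing
  ; at-pivot = refl ; elsewhere = λ _ → refl }
... | no  c≮h₀ = record
  { pivot = fs pivot ; extension = cons (h fz) extension
  ; increasing = cons-increasing h₀<extension increasing
  ; at-pivot = at-pivot ; elsewhere = λ { fz → refl ; (fs a) → elsewhere a } }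
  where
  open Insertion (insert (h-increasing ∘ s≤s) c (c∉h ∘ fs))
  h₀<extension : ∀ b → h fz Fin.< extension b
  h₀<extension b with punchIn-or-pivot pivot b
  ... | inj₁ refl       =
    subst (h fz Fin.<_) (sym at-pivot) (≤∧≢⇒< (≮⇒≥ c≮h₀) (c∉h fz ∘ toℕ-injective))
  ... | inj₂ (a , refl) = subst (h fz Fin.<_) (sym (elsewhere a)) (h-increasing {fz} {fs a} z<s)

surjective⇒≤ : {g : Fin n → Fin k} → StrictlySurjective _≡_ g → k ≤ n
surjective⇒≤ {g = g} g-surjective = injective⇒≤ section-injective
  where
  section-injective : Injective _≡_ _≡_ (proj₁ ∘ g-surjective)
  section-injective {b} {b′} eq =
    trans (sym (proj₂ (g-surjective b))) (trans (cong g eq) (proj₂ (g-surjective b′)))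

record IsFactorisation (t : Fin n → Fin m) (g : Fin n → Fin k) (h : Fin k → Fin m) : Set where
  field
    surjective : StrictlySurjective _≡_ g
    increasing : Increasing h
    factors    : t ≗ h ∘ g

record Factorisation (t : Fin n → Fin m) : Set where
  field
    size            : ℕ
    g               : Fin n → Fin size
    h               : Fin size → Fin m
    isFactorisation : IsFactorisation t g h

factorise : (t : Fin n → Fin m) → Factorisation t
factorise {zero} t = record
  { size = 0 ; g = λ () ; h = λ ()
  ; isFactorisation = record { surjective = λ () ; increasing = λ { {()} } ; factors = λ () } }
factorise {suc n} t with factorise (t ∘ fs)
... | record { size = k ; g = g ; h = h ; isFactorisation = F } with any? (λ a → h a ≟ t fz)
...   | yes (a , ha≡t₀) = record
  { size = k ; g = cons a g ; h = h
  ; isFactorisation = record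
    { surjective = λ b → let (v , gv≡b) = surjective b in fs v , gv≡b
    ; increasing = increasing
    ; factors    = λ { fz → sym ha≡t₀ ; (fs v) → factors v } } }
  where open IsFactorisation F
...   | no  t₀∉h = record
  { size = suc k ; g = cons pivot (punchIn pivot ∘ g) ; h = extension
  ; isFactorisation = record
    { surjective = surjective′
    ; increasing = Insertion.increasing I
    ; factors    = λ { fz → sym at-pivot ; (fs v) → trans (factors v) (sym (elsewhere (g v))) } } }
  where
  open IsFactorisation F
  I : Insertion h (t fz)
  I = insert increasing (t fz) (λ a ha≡t₀ → t₀∉h (a , ha≡t₀))
  open Insertion I using (pivot; extension; at-pivot; elsewhere)
  surjective′ : StrictlySurjective _≡_ (cons pivot (punchIn pivot ∘ g))
  surjective′ b with punchIn-or-pivot pivot b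
  ... | inj₁ b≡p        = fz , sym b≡p
  ... | inj₂ (a , refl) = let (v , gv≡a) = surjective a in fs v , cong (punchIn pivot) gv≡a

module _ {t : Fin n → Fin m} {k′} {g : Fin n → Fin k} {h : Fin k → Fin m}
         {g′ : Fin n → Fin k′} {h′ : Fin k′ → Fin m} where
  open IsFactorisation

  comparison : IsFactorisation t g h → IsFactorisation t g′ h′ → Fin k → Fin k′
  comparison F F′ a = g′ (proj₁ (surjective F a))

  comparison-commutes : (F : IsFactorisation t g h) (F′ : IsFactorisation t g′ h′) →
                        h′ ∘ comparison F F′ ≗ h
  comparison-commutes F F′ a with surjective F a
  ... | v , refl = trans (sym (factors F′ v)) (factors F v)

  comparison-increasing : (F : IsFactorisation t g h) (F′ : IsFactorisation t g′ h′) →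
                          Increasing (comparison F F′)
  comparison-increasing F F′ {a} {b} a<b = increasing-cancel-< (increasing F′)
    (subst₂ Fin._<_ (sym (comparison-commutes F F′ a)) (sym (comparison-commutes F F′ b)) (increasing F a<b))

module _ {t : Fin n → Fin m} {k′} {g : Fin n → Fin k} {h : Fin k → Fin m}
         {g′ : Fin n → Fin k′} {h′ : Fin k′ → Fin m}
         (F : IsFactorisation t g h) (F′ : IsFactorisation t g′ h′) where
  open IsFactorisation

  factorisation-size-unique : k ≡ k′
  factorisation-size-unique = cantor-schröder-bernstein
    (increasing⇒injective (comparison-increasing F F′)) (increasing⇒injective (comparison-increasing F′ F))

  -- Both comparison maps are increasing, hence inflationary, and they are mutually inverse.
  comparison-toℕ : ∀ a → toℕ (comparison F F′ a) ≡ toℕ a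
  comparison-toℕ a = ≤-antisym
    (≤-trans (increasing⇒inflationary (comparison-increasing F′ F) (comparison F F′ a))
             (≤-reflexive (cong toℕ there-and-back)))
    (increasing⇒inflationary (comparison-increasing F F′) a)
    where
    there-and-back : comparison F′ F (comparison F F′ a) ≡ a
    there-and-back = increasing⇒injective (increasing F)
      (trans (comparison-commutes F′ F _) (comparison-commutes F F′ a))

factorisation-unique : {t : Fin n → Fin m} {g g′ : Fin n → Fin k} {h h′ : Fin k → Fin m} →
                       IsFactorisation t g h → IsFactorisation t g′ h′ → g ≗ g′ × h ≗ h′
factorisation-unique {g = g} {g′} {h} {h′} F F′ = g≗g′ , h≗h′
  where
  open IsFactorisation
  h≗h′ : h ≗ h′
  h≗h′ a = trans (sym (comparison-commutes F F′ a)) (cong h′ (toℕ-injective (comparison-toℕ F F′ a)))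
  g≗g′ : g ≗ g′
  g≗g′ v = increasing⇒injective (increasing F)
    (trans (sym (factors F v)) (trans (factors F′ v) (sym (h≗h′ (g′ v)))))

isFactorisation-resp : {t : Fin n → Fin m} {g g′ : Fin n → Fin k} {h h′ : Fin k → Fin m} →
                       g ≗ g′ → h ≗ h′ → IsFactorisation t g h → IsFactorisation t g′ h′
isFactorisation-resp {h′ = h′} g≗g′ h≗h′ F = record
  { surjective = λ b → let (v , gv≡b) = surjective b in v , trans (sym (g≗g′ v)) gv≡b
  ; increasing = λ {a} {b} a<b → subst₂ Fin._<_ (h≗h′ a) (h≗h′ b) (increasing a<b)
  ; factors    = λ v → trans (factors v) (trans (h≗h′ _) (cong h′ (g≗g′ v))) }
  where open IsFactorisation F

T-isSurjᵇ : {g : Fin n → Fin k} → T (isSurjᵇ g) ⇔ StrictlySurjective _≡_ g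
T-isSurjᵇ = mk⇔
  (λ g-surj b → let (v , gv==b) = to T-anyᵇ (to T-allᵇ g-surj b) in v , to T-==F gv==b)
  (λ g-surj → from T-allᵇ λ b → from T-anyᵇ (map-× id (from T-==F) (g-surj b)))

isFactorisationᵇ : (t : Fin n → Fin m) (g : Fin n → Fin k) (h : Fin k → Fin m) → Bool
isFactorisationᵇ t g h = (isSurjᵇ g ∧ increasingᵇ h) ∧ (t ≗ᵇ h ∘ g)

T-isFactorisationᵇ : {t : Fin n → Fin m} {g : Fin n → Fin k} {h : Fin k → Fin m} →
                     T (isFactorisationᵇ t g h) ⇔ IsFactorisation t g h
T-isFactorisationᵇ {t = t} {g} {h} = mk⇔ to′ from′
  where
  open IsFactorisation
  to′ : T (isFactorisationᵇ t g h) → IsFactorisation t g h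
  to′ F with to T-∧ F
  ... | g-surj∧h-inc , t≗ᵇhg with to T-∧ g-surj∧h-inc
  ... | g-surj , h-inc = record
    { surjective = to T-isSurjᵇ g-surj
    ; increasing = to (T-increasingᵇ {h = h}) h-inc
    ; factors    = to T-≗ᵇ t≗ᵇhg }
  from′ : IsFactorisation t g h → T (isFactorisationᵇ t g h)
  from′ F = from T-∧ ( from T-∧ (from T-isSurjᵇ (surjective F) , from (T-increasingᵇ {h = h}) (increasing F))
                     , from T-≗ᵇ (factors F))

factorisations-count : (t : Fin n → Fin m) (x : ℕ) →
  ∑[ k ∈ upTo (suc n) ] ∑[ g ∈ funs n k ] ∑[ h ∈ funs k m ] (𝟙 (isFactorisationᵇ t g h) * x) ≡ x
factorisations-count {n} {m} t x =
  trans (∑-applyUpTo-single id count (s≤s (surjective⇒≤ (surjective F₀))) vanish) at-k₀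
  where
  open Factorisation (factorise t) renaming (size to k₀; g to g₀; h to h₀; isFactorisation to F₀)
  open IsFactorisation
  count : ℕ → ℕ
  count k = ∑[ g ∈ funs n k ] ∑[ h ∈ funs k m ] (𝟙 (isFactorisationᵇ t g h) * x)
  vanish : ∀ k → k ≢ k₀ → count k ≡ 0
  vanish k k≢k₀ = trans
    (∑-cong (funs n k) (λ g → trans
      (∑-cong (funs k m) (λ h → cong (_* x) (𝟙-false
        (k≢k₀ ∘ (λ F → factorisation-size-unique F F₀) ∘ to (T-isFactorisationᵇ {h = h})))))
      (∑-zero (funs k m))))
    (∑-zero (funs n k))
  unique : ∀ g h → isFactorisationᵇ t g h ≡ (g ≗ᵇ g₀) ∧ (h ≗ᵇ h₀)
  unique g h = T-injective (mk⇔
    (λ F → let (g≗g₀ , h≗h₀) = factorisation-unique (to (T-isFactorisationᵇ {h = h}) F) F₀ in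
           from T-∧ (from T-≗ᵇ g≗g₀ , from T-≗ᵇ h≗h₀))
    (λ g₀h₀ → let (g≗ᵇg₀ , h≗ᵇh₀) = to T-∧ g₀h₀ in from (T-isFactorisationᵇ {h = h})
      (isFactorisation-resp (sym ∘ to T-≗ᵇ g≗ᵇg₀) (sym ∘ to T-≗ᵇ h≗ᵇh₀) F₀)))
  at-k₀ : count k₀ ≡ x
  at-k₀ = begin
    ∑[ g ∈ funs n k₀ ] ∑[ h ∈ funs k₀ m ] (𝟙 (isFactorisationᵇ t g h) * x)
      ≡⟨ ∑-cong (funs n k₀) (λ g → ∑-cong (funs k₀ m) (λ h →
           trans (cong (λ b → 𝟙 b * x) (unique g h)) (𝟙-∧-* (g ≗ᵇ g₀) (h ≗ᵇ h₀) x))) ⟩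
    ∑[ g ∈ funs n k₀ ] ∑[ h ∈ funs k₀ m ] (𝟙 (g ≗ᵇ g₀) * (𝟙 (h ≗ᵇ h₀) * x))
      ≡⟨ ∑-cong (funs n k₀) (λ g → *-distribˡ-∑ (𝟙 (g ≗ᵇ g₀)) (funs k₀ m) _) ⟨
    ∑[ g ∈ funs n k₀ ] (𝟙 (g ≗ᵇ g₀) * ∑[ h ∈ funs k₀ m ] (𝟙 (h ≗ᵇ h₀) * x))
      ≡⟨ ∑-cong (funs n k₀) (λ g →
           cong (𝟙 (g ≗ᵇ g₀) *_) (∑-funs-δ h₀ (λ _ → x) (λ _ → refl))) ⟩
    ∑[ g ∈ funs n k₀ ] (𝟙 (g ≗ᵇ g₀) * x)
      ≡⟨ ∑-funs-δ g₀ (λ _ → x) (λ _ → refl) ⟩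
    x ∎
    where open ≡-Reasoning

compositions : (n k : ℕ) → List (Fin n → Fin k)
compositions n k = filterᵇ isSurjᵇ (funs n k)

increasingMaps : (k m : ℕ) → List (Fin k → Fin m)
increasingMaps k m = filterᵇ increasingᵇ (funs k m)

∑-factorisations : (w : (Fin n → Fin m) → ℕ) → w Preserves _≗_ ⟶ _≡_ →
  ∑[ k ∈ upTo (suc n) ] ∑[ g ∈ compositions n k ] ∑[ h ∈ increasingMaps k m ] w (h ∘ g)
    ≡ ∑ (funs n m) w
∑-factorisations {n} {m} w w-resp = begin
  ∑[ k ∈ ks ] ∑[ g ∈ compositions n k ] ∑[ h ∈ increasingMaps k m ] w (h ∘ g)
    ≡⟨ ∑-cong ks (λ k → ∑-filterᵇ² isSurjᵇ increasingᵇ (funs n k) (funs k m) _) ⟩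
  ∑[ k ∈ ks ] ∑[ g ∈ funs n k ] ∑[ h ∈ funs k m ] (𝟙 (isSurjᵇ g ∧ increasingᵇ h) * w (h ∘ g))
    ≡⟨ ∑-cong ks (λ k → ∑-cong (funs n k) (λ g → ∑-cong (funs k m) (spread g))) ⟩
  ∑[ k ∈ ks ] ∑[ g ∈ funs n k ] ∑[ h ∈ funs k m ] ∑[ t ∈ ts ] term t g h
    ≡⟨ ∑-cong ks (λ k → ∑-cong (funs n k) (λ g → ∑-swap (funs k m) ts _)) ⟩
  ∑[ k ∈ ks ] ∑[ g ∈ funs n k ] ∑[ t ∈ ts ] ∑[ h ∈ funs k m ] term t g h
    ≡⟨ ∑-cong ks (λ k → ∑-swap (funs n k) ts _) ⟩
  ∑[ k ∈ ks ] ∑[ t ∈ ts ] ∑[ g ∈ funs n k ] ∑[ h ∈ funs k m ] term t g h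
    ≡⟨ ∑-swap ks ts _ ⟩
  ∑[ t ∈ ts ] ∑[ k ∈ ks ] ∑[ g ∈ funs n k ] ∑[ h ∈ funs k m ] term t g h
    ≡⟨ ∑-cong ts (λ t → factorisations-count t (w t)) ⟩
  ∑[ t ∈ ts ] w t ∎
  where
  open ≡-Reasoning
  ks : List ℕ
  ks = upTo (suc n)
  ts : List (Fin n → Fin m)
  ts = funs n m
  term : (t : Fin n → Fin m) → (Fin n → Fin k) → (Fin k → Fin m) → ℕ
  term t g h = 𝟙 (isFactorisationᵇ t g h) * w t
  spread : (g : Fin n → Fin k) (h : Fin k → Fin m) →
           𝟙 (isSurjᵇ g ∧ increasingᵇ h) * w (h ∘ g) ≡ ∑[ t ∈ ts ] term t g h
  spread g h = begin
    𝟙 (isSurjᵇ g ∧ increasingᵇ h) * w (h ∘ g)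
      ≡⟨ cong (𝟙 (isSurjᵇ g ∧ increasingᵇ h) *_) (∑-funs-δ (h ∘ g) w w-resp) ⟨
    𝟙 (isSurjᵇ g ∧ increasingᵇ h) * ∑[ t ∈ ts ] (𝟙 (t ≗ᵇ h ∘ g) * w t)
      ≡⟨ *-distribˡ-∑ (𝟙 (isSurjᵇ g ∧ increasingᵇ h)) ts (λ t → 𝟙 (t ≗ᵇ h ∘ g) * w t) ⟩
    ∑[ t ∈ ts ] (𝟙 (isSurjᵇ g ∧ increasingᵇ h) * (𝟙 (t ≗ᵇ h ∘ g) * w t))
      ≡⟨ ∑-cong ts (λ t → 𝟙-∧-* (isSurjᵇ g ∧ increasingᵇ h) (t ≗ᵇ h ∘ g) (w t)) ⟨
    ∑[ t ∈ ts ] term t g h ∎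

-- The monomials of F_I and the coefficients of U_X

-- I is a set of 1-based positions, whence suc (toℕ i).
Compatible : (ℕ → Bool) → (Fin n → Fin m) → Set
Compatible I s = ∀ i j → toℕ j ≡ suc (toℕ i) → s i Fin.≤ s j × (T (I (suc (toℕ i))) → s i Fin.< s j)

compatibleᵇ : (ℕ → Bool) → (Fin n → Fin m) → Bool
compatibleᵇ I s = allᵇ λ i → allᵇ λ j → nextᵇ i j ⇒ᵇ
  ((toℕ (s i) ≤ᵇ toℕ (s j)) ∧ (I (suc (toℕ i)) ⇒ᵇ (toℕ (s i) <ᵇ toℕ (s j))))

T-compatibleᵇ : ∀ {I} {s : Fin n → Fin m} → T (compatibleᵇ I s) ⇔ Compatible I s
T-compatibleᵇ {I = I} {s} = mk⇔ to′ from′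
  where
  to′ : T (compatibleᵇ I s) → Compatible I s
  to′ c i j j≡1+i =
    let (weak , strict) = to T-∧ (to T-⇒ᵇ (to T-allᵇ (to T-allᵇ c i) j) (from T-nextᵇ j≡1+i))
    in to T-≤ᵇ weak , to T-<ᵇ ∘ to (T-⇒ᵇ {I (suc (toℕ i))}) strict
  from′ : Compatible I s → T (compatibleᵇ I s)
  from′ c = from T-allᵇ λ i → from T-allᵇ λ j → from (T-⇒ᵇ {nextᵇ i j}) λ next →
    let (weak , strict) = c i j (to T-nextᵇ next)
    in from T-∧ (from T-≤ᵇ weak , from (T-⇒ᵇ {I (suc (toℕ i))}) (from T-<ᵇ ∘ strict))

compatible-∘-increasing : ∀ {I} {s : Fin n → Fin k} {h : Fin k → Fin m} →
                          Increasing h → Compatible I (h ∘ s) ⇔ Compatible I s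
compatible-∘-increasing h-inc = mk⇔
  (λ c i j j≡1+i → map-× (increasing-cancel-≤ h-inc) (increasing-cancel-< h-inc ∘_) (c i j j≡1+i))
  (λ c i j j≡1+i → map-× (increasing-mono-≤ h-inc) (h-inc ∘_) (c i j j≡1+i))

compatible-cong : ∀ {I} {s s′ : Fin n → Fin m} → s ≗ s′ → Compatible I s → Compatible I s′
compatible-cong {I = I} s≗s′ c i j j≡1+i =
  subst₂ (λ x y → x Fin.≤ y × (T (I (suc (toℕ i))) → x Fin.< y)) (s≗s′ i) (s≗s′ j) (c i j j≡1+i)

compatibleᵇ-∘-increasing : ∀ I (s : Fin n → Fin k) {h : Fin k → Fin m} →
                           Increasing h → compatibleᵇ I (h ∘ s) ≡ compatibleᵇ I s
compatibleᵇ-∘-increasing I s {h} h-inc =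
  ⇔⇒≡ (T-compatibleᵇ {I = I} {h ∘ s}) (T-compatibleᵇ {I = I} {s}) (compatible-∘-increasing {I = I} h-inc)

compatibleᵇ-cong : ∀ I {s s′ : Fin n → Fin m} → s ≗ s′ → compatibleᵇ I s ≡ compatibleᵇ I s′
compatibleᵇ-cong I {s} {s′} s≗s′ = ⇔⇒≡ (T-compatibleᵇ {I = I} {s}) (T-compatibleᵇ {I = I} {s′})
  (mk⇔ (compatible-cong {I = I} s≗s′) (compatible-cong {I = I} (sym ∘ s≗s′)))

mult-as-∑ : (s : Fin a → Fin m) (c : Fin m) → mult s c ≡ ∑[ i ∈ allFin a ] 𝟙 (s i ==F c)
mult-as-∑ {a} s c = length-filterᵇ (λ i → s i ==F c) (allFin a)

hasContentᵇ-mult : {s : Fin a → Fin m} {s′ : Fin b → Fin m} (α : Fin m → ℕ) →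
                   (∀ c → mult s c ≡ mult s′ c) → hasContentᵇ s α ≡ hasContentᵇ s′ α
hasContentᵇ-mult α mult-s≡mult-s′ = allᵇ-cong (λ c → cong (_≡ᵇ α c) (mult-s≡mult-s′ c))

hasContentᵇ-cong : {s s′ : Fin a → Fin m} (α : Fin m → ℕ) → s ≗ s′ →
                   hasContentᵇ s α ≡ hasContentᵇ s′ α
hasContentᵇ-cong {a} {s = s} {s′} α s≗s′ = hasContentᵇ-mult {s = s} {s′} α λ c →
  trans (mult-as-∑ s c)
        (trans (∑-cong (allFin a) (λ i → cong (λ x → 𝟙 (x ==F c)) (s≗s′ i))) (sym (mult-as-∑ s′ c)))

hasContentᵇ-∘-injective : {σ : Fin n → Fin n} → Injective _≡_ _≡_ σ →
                          (s : Fin n → Fin m) (α : Fin m → ℕ) →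
                          hasContentᵇ (s ∘ σ) α ≡ hasContentᵇ s α
hasContentᵇ-∘-injective {σ = σ} σ-injective s α = hasContentᵇ-mult {s = s ∘ σ} {s} α λ c →
  trans (mult-as-∑ (s ∘ σ) c)
        (trans (∑-allFin-∘-injective σ-injective (λ i → 𝟙 (s i ==F c))) (sym (mult-as-∑ s c)))

Fcoeff-expansion : (I : ℕ → Bool) (α : Fin m → ℕ) {σ : Fin n → Fin n} → Injective _≡_ _≡_ σ →
  Fcoeff n m I α ≡ ∑[ k ∈ upTo (suc n) ] ∑[ g ∈ compositions n k ] ∑[ h ∈ increasingMaps k m ]
                     (𝟙 (compatibleᵇ I (g ∘ σ)) * 𝟙 (hasContentᵇ (h ∘ g) α))
Fcoeff-expansion {m} {n} I α {σ} σ-injective = begin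
  Fcoeff n m I α
    ≡⟨ length-filterᵇ counted (funs n m) ⟩
  ∑[ s ∈ funs n m ] 𝟙 (counted s)
    ≡⟨ ∑-funs-∘-injective σ-injective (𝟙 ∘ counted) counted-resp ⟨
  ∑[ f ∈ funs n m ] 𝟙 (counted (f ∘ σ))
    ≡⟨ ∑-factorisations (λ f → 𝟙 (counted (f ∘ σ))) (λ f≗f′ → counted-resp (f≗f′ ∘ σ)) ⟨
  ∑[ k ∈ ks ] ∑[ g ∈ compositions n k ] ∑[ h ∈ increasingMaps k m ] 𝟙 (counted (h ∘ g ∘ σ))
    ≡⟨ ∑-cong ks (λ k → ∑-cong (compositions n k) (λ g →
         ∑-filterᵇ-cong increasingᵇ (funs k m) (split g))) ⟩
  ∑[ k ∈ ks ] ∑[ g ∈ compositions n k ] ∑[ h ∈ increasingMaps k m ]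
    (𝟙 (compatibleᵇ I (g ∘ σ)) * 𝟙 (hasContentᵇ (h ∘ g) α)) ∎
  where
  open ≡-Reasoning
  ks : List ℕ
  ks = upTo (suc n)
  counted : (Fin n → Fin m) → Bool
  counted s = compatibleᵇ I s ∧ hasContentᵇ s α
  counted-resp : (𝟙 ∘ counted) Preserves _≗_ ⟶ _≡_
  counted-resp s≗s′ = cong 𝟙 (cong₂ _∧_ (compatibleᵇ-cong I s≗s′) (hasContentᵇ-cong α s≗s′))
  split : ∀ {k} (g : Fin n → Fin k) h → T (increasingᵇ h) →
          𝟙 (counted (h ∘ g ∘ σ)) ≡ 𝟙 (compatibleᵇ I (g ∘ σ)) * 𝟙 (hasContentᵇ (h ∘ g) α)
  split g h h-inc = trans
    (cong 𝟙 (cong₂ _∧_ (compatibleᵇ-∘-increasing I (g ∘ σ) (to (T-increasingᵇ {h = h}) h-inc))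
                       (hasContentᵇ-∘-injective σ-injective (h ∘ g) α)))
    (𝟙-∧ (compatibleᵇ I (g ∘ σ)) (hasContentᵇ (h ∘ g) α))

listing⇒injective : {σ : Fin n → Fin n} → T (isListingᵇ σ) → Injective _≡_ _≡_ σ
listing⇒injective {σ = σ} σ-listing {i} {j} σi≡σj =
  toWitness (to (T-⇒ᵇ {σ i ==F σ j}) (to T-allᵇ (to T-allᵇ σ-listing i) j) (fromWitness σi≡σj))

XDes-next : (E : Digraph n) (σ : Fin n → Fin n) {i j : Fin n} → T (nextᵇ i j) →
            XDes E σ (suc (toℕ i)) ≡ E (σ i) (σ j)
XDes-next E σ {i} {j} next = T-injective (mk⇔ to′ from′)
  where
  to′ : T (XDes E σ (suc (toℕ i))) → T (E (σ i) (σ j))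
  to′ des with to T-anyᵇ des
  ... | i′ , des′ with to T-anyᵇ des′
  ... | j′ , des″ with to T-∧ des″
  ... | next′ , at-i∧edge with to T-∧ at-i∧edge
  ... | at-i , edge = subst₂ (λ a b → T (E (σ a) (σ b))) i′≡i j′≡j edge
    where
    i′≡i : i′ ≡ i
    i′≡i = toℕ-injective (≡ᵇ⇒≡ (toℕ i′) (toℕ i) at-i)
    j′≡j : j′ ≡ j
    j′≡j = toℕ-injective
      (trans (to T-nextᵇ next′) (trans (cong (suc ∘ toℕ) i′≡i) (sym (to T-nextᵇ next))))
  from′ : T (E (σ i) (σ j)) → T (XDes E σ (suc (toℕ i)))
  from′ edge = from T-anyᵇ (i , from T-anyᵇ (j ,
    from T-∧ (next , from T-∧ (≡⇒≡ᵇ (toℕ i) (toℕ i) refl , edge))))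

IsFXFriendly⇔compatible : (E : Digraph n) (g : Fin n → Fin k) (σ : Fin n → Fin n) →
                          IsFXFriendly E g σ ⇔ Compatible (XDes E σ) (g ∘ σ)
IsFXFriendly⇔compatible E g σ = mk⇔ to′ from′
  where
  to′ : IsFXFriendly E g σ → Compatible (XDes E σ) (g ∘ σ)
  to′ (f , (_ , f-const , f-mono) , f-friendly) i j j≡1+i =
    let (f≤ , f<) = f-friendly i j j≡1+i
        g≤ = ≮⇒≥ (λ gj<gi → <⇒≱ (f-mono (σ j) (σ i) gj<gi) f≤)
    in g≤ , λ des → ≤∧≢⇒< g≤ λ gi≡gj →
         <-irrefl (f-const (σ i) (σ j) (toℕ-injective gi≡gj))
                  (f< (to T-≡ (subst T (XDes-next E σ (from T-nextᵇ j≡1+i)) des)))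
  from′ : Compatible (XDes E σ) (g ∘ σ) → IsFXFriendly E g σ
  from′ c = suc ∘ toℕ ∘ g , ((λ _ → s≤s z≤n) , (λ _ _ → cong (suc ∘ toℕ)) , (λ _ _ → s≤s)) ,
    λ i j j≡1+i → let (g≤ , g<) = c i j j≡1+i in
      s≤s g≤ , λ edge → s≤s (g< (subst T (sym (XDes-next E σ (from T-nextᵇ j≡1+i))) (from T-≡ edge)))

HasCount⇒∑ : {P : A → Set} (p : A → Bool) → (∀ x → P x ⇔ T (p x)) → ∀ {xs c} →
             HasCount P xs c → c ≡ ∑[ x ∈ xs ] 𝟙 (p x)
HasCount⇒∑ p P⇔p hc-[]                 = refl
HasCount⇒∑ p P⇔p (hc-yes {x} Px count) =
  cong₂ _+_ (sym (𝟙-true (to (P⇔p x) Px))) (HasCount⇒∑ p P⇔p count)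
HasCount⇒∑ p P⇔p (hc-no {x} ¬Px count) =
  cong₂ _+_ (sym (𝟙-false (¬Px ∘ from (P⇔p x)))) (HasCount⇒∑ p P⇔p count)

friendly-count : (E : Digraph n) (g : Fin n → Fin k) → ∀ {c} →
                 HasCount (IsFXFriendly E g) (listings n) c →
                 c ≡ ∑[ σ ∈ listings n ] 𝟙 (compatibleᵇ (XDes E σ) (g ∘ σ))
friendly-count E g = HasCount⇒∑ (λ σ → compatibleᵇ (XDes E σ) (g ∘ σ))
  (λ σ → ⇔-sym (T-compatibleᵇ {I = XDes E σ} {g ∘ σ}) ⇔-∘ IsFXFriendly⇔compatible E g σ)

Mcoeff-∑ : (g : Fin n → Fin k) (α : Fin m → ℕ) →
           Mcoeff g m α ≡ ∑[ h ∈ increasingMaps k m ] 𝟙 (hasContentᵇ (h ∘ g) α)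
Mcoeff-∑ {k = k} {m} g α = begin
  Mcoeff g m α
    ≡⟨ length-filterᵇ _ (funs k m) ⟩
  ∑[ h ∈ funs k m ] 𝟙 (increasingᵇ h ∧ hasContentᵇ (h ∘ g) α)
    ≡⟨ ∑-cong (funs k m) (λ h → 𝟙-∧ (increasingᵇ h) (hasContentᵇ (h ∘ g) α)) ⟩
  ∑[ h ∈ funs k m ] (𝟙 (increasingᵇ h) * 𝟙 (hasContentᵇ (h ∘ g) α))
    ≡⟨ ∑-filterᵇ increasingᵇ (funs k m) _ ⟨
  ∑[ h ∈ increasingMaps k m ] 𝟙 (hasContentᵇ (h ∘ g) α) ∎
  where open ≡-Reasoning

sumCompositions-∑ : (t : (k : ℕ) → (Fin n → Fin k) → ℕ) →
                    sumCompositions n t ≡ ∑[ k ∈ upTo (suc n) ] ∑[ g ∈ compositions n k ] t k g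
sumCompositions-∑ {n} t =
  trans (sum-map (upTo (suc n)) _) (∑-cong (upTo (suc n)) (λ k → sum-map (compositions n k) (t k)))

mainTheorem4 : (n : ℕ) (E : Digraph n) → Loopless E →
    (c : (k : ℕ) → (Fin n → Fin k) → ℕ) →
    (∀ k (g : Fin n → Fin k) → isSurjᵇ g ≡ true →
       HasCount (IsFXFriendly E g) (listings n) (c k g)) →
    (m : ℕ) (α : Fin m → ℕ) →
    Ucoeff E m α ≡ sumCompositions n (λ k g → c k g * Mcoeff g m α)
mainTheorem4 n E _ c count m α = begin
  Ucoeff E m α
    ≡⟨ sum-map σs _ ⟩
  ∑[ σ ∈ σs ] Fcoeff n m (XDes E σ) α
    ≡⟨ ∑-filterᵇ-cong isListingᵇ (funs n n) (λ σ →
         Fcoeff-expansion (XDes E σ) α ∘ listing⇒injective {σ = σ}) ⟩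
  ∑[ σ ∈ σs ] ∑[ k ∈ ks ] ∑[ g ∈ gs k ] ∑[ h ∈ hs k ] (friendly g σ * content g h)
    ≡⟨ ∑-swap σs ks _ ⟩
  ∑[ k ∈ ks ] ∑[ σ ∈ σs ] ∑[ g ∈ gs k ] ∑[ h ∈ hs k ] (friendly g σ * content g h)
    ≡⟨ ∑-cong ks (λ k → ∑-swap σs (gs k) _) ⟩
  ∑[ k ∈ ks ] ∑[ g ∈ gs k ] ∑[ σ ∈ σs ] ∑[ h ∈ hs k ] (friendly g σ * content g h)
    ≡⟨ ∑-cong ks (λ k → ∑-cong (gs k) (λ g → ∑-*-∑ σs (hs k) (friendly g) (content g))) ⟩
  ∑[ k ∈ ks ] ∑[ g ∈ gs k ] (∑ σs (friendly g) * ∑ (hs k) (content g))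
    ≡⟨ ∑-cong ks (λ k → ∑-filterᵇ-cong isSurjᵇ (funs n k) (λ g g-surjective →
         sym (cong₂ _*_ (friendly-count E g (count k g (to T-≡ g-surjective))) (Mcoeff-∑ g α)))) ⟩
  ∑[ k ∈ ks ] ∑[ g ∈ gs k ] (c k g * Mcoeff g m α)
    ≡⟨ sumCompositions-∑ (λ k g → c k g * Mcoeff g m α) ⟨
  sumCompositions n (λ k g → c k g * Mcoeff g m α) ∎
  where
  open ≡-Reasoning
  σs : List (Fin n → Fin n)
  σs = listings n
  ks : List ℕ
  ks = upTo (suc n)
  gs : (k : ℕ) → List (Fin n → Fin k)
  gs = compositions n
  hs : (k : ℕ) → List (Fin k → Fin m)
  hs k = increasingMaps k m
  friendly : (Fin n → Fin k) → (Fin n → Fin n) → ℕ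
  friendly g σ = 𝟙 (compatibleᵇ (XDes E σ) (g ∘ σ))
  content : (Fin n → Fin k) → (Fin k → Fin m) → ℕ
  content g h = 𝟙 (hasContentᵇ (h ∘ g) α)
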